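{- Let $k>\ell\ge1$ be integers, $p$ a prime, $n\ge2$, and let $A\subset\mathbb F_p^n$ be $(k,\ell)$-sum-free. Fix a decomposition $(v,K)$ of $\mathbb F_p^n$. Let $r_1,\dots,r_k,s_1,\dots,s_\ell\in[\omega]$ (not necessarily distinct). If either (1) $\big(\sum_{i=1}^kC_{r_i}\big)\cap\big(\sum_{j=1}^\ell C_{s_j}\big)\ne\emptyset$, or (2) $\sum_{i=1}^kr_i+\sum_{j=1}^\ell s_j\ge p+k+\ell-1$, then $\sum_{i=1}^k\beta_{r_i}+\sum_{j=1}^\ell\beta_{s_j}\le p+k+\ell-2$.
   Context: For sets in an abelian group, sums denote sumsets and $hX=\{x_1+\dots+x_h:x_i\in X\}$; $A$ is $(k,\ell)$-sum-free if $A\ne\emptyset$ and $kA\cap\ell A=\emptyset$. A decomposition $(v,K)$: $K$ a subspace of dimension $n-1$, $v\notin K$. Put $A_i=(A-iv)\cap K$ ($i\in\mathbb F_p$), $\omega=|\{i:A_i\ne\emptyset\}|$, choose an ordering $b_1,\dots,b_p$ of $\mathbb F_p$ with $|A_{b_1}|\ge\dots\ge|A_{b_p}|$, and set $C_i=\{b_1,\dots,b_i\}\subseteq\mathbb F_p$, $\beta_i=|A_{b_i}|/p^{n-2}$; $[\omega]=\{1,\dots,\omega\}$. -}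

module Defs where

open import Data.Nat using (ℕ; zero; suc; _+_; _*_; NonZero; _<ᵇ_)
open import Data.Nat.DivMod using (_mod_)
open import Data.Fin using (Fin; toℕ) renaming (zero to fzero; suc to fsuc)
open import Data.Fin.Properties using () renaming (_≟_ to _≟F_)
open import Data.Vec using (Vec; []; _∷_; zipWith; map; replicate)
open import Data.Vec.Properties using (≡-dec)
open import Data.List using (List; []; _∷_; concatMap; length; filter; allFin)
open import Data.Bool.ListAction using (any)
import Data.List as L
open import Data.Bool using (Bool; true; false; _∧_; not)
open import Data.Product using (Σ; _×_; _,_; ∃)
open import Relation.Nullary using (¬_; does)
open import Relation.Binary.PropositionalEquality using (_≡_)

sumℕ : ∀ {m} → (Fin m → ℕ) → ℕ
sumℕ {zero} f = 0
sumℕ {suc m} f = f fzero + sumℕ (λ i → f (fsuc i))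

module _ (p : ℕ) {{_ : NonZero p}} where

  𝔽 : Set
  𝔽 = Fin p

  0𝔽 : 𝔽
  0𝔽 = 0 mod p

  _+𝔽_ : 𝔽 → 𝔽 → 𝔽
  a +𝔽 b = (toℕ a + toℕ b) mod p

  _*𝔽_ : 𝔽 → 𝔽 → 𝔽
  a *𝔽 b = (toℕ a * toℕ b) mod p

  sum𝔽 : ∀ {m} → (Fin m → 𝔽) → 𝔽
  sum𝔽 {zero} f = 0𝔽
  sum𝔽 {suc m} f = f fzero +𝔽 sum𝔽 (λ i → f (fsuc i))

  V : ℕ → Set
  V n = Vec 𝔽 n

  0V : ∀ {n} → V n
  0V = replicate _ 0𝔽

  _+V_ : ∀ {n} → V n → V n → V n
  _+V_ = zipWith _+𝔽_

  _·V_ : ∀ {n} → 𝔽 → V n → V n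
  c ·V x = map (c *𝔽_) x

  sumV : ∀ {n m} → (Fin m → V n) → V n
  sumV {n} {zero} f = 0V
  sumV {n} {suc m} f = f fzero +V sumV (λ i → f (fsuc i))

  lincomb : ∀ {n d} → (Fin d → V n) → (Fin d → 𝔽) → V n
  lincomb w c = sumV (λ j → c j ·V w j)

  allVecs : (m : ℕ) → List (V m)
  allVecs zero = [] ∷ []
  allVecs (suc m) = concatMap (λ a → L.map (a ∷_) (allVecs m)) (allFin p)

  LinIndep : ∀ {n d} → (Fin d → V n) → Set
  LinIndep w = ∀ c → lincomb w c ≡ 0V → ∀ j → c j ≡ 0𝔽

  inSpan : ∀ {n d} → (Fin d → V n) → V n → Bool
  inSpan {n} {d} w x =
    any (λ c → does (≡-dec _≟F_ (lincomb w (λ j → Data.Vec.lookup c j)) x)) (allVecs d)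

  Subset : ℕ → Set
  Subset n = V n → Bool

  SumFree : ∀ {n} → ℕ → ℕ → Subset n → Set
  SumFree {n} k l A =
    (∃ λ x → A x ≡ true) ×
    ¬ (Σ (Fin k → V n) λ a → Σ (Fin l → V n) λ b →
         (∀ i → A (a i) ≡ true) × (∀ j → A (b j) ≡ true) × (sumV a ≡ sumV b))

  -- |A_i| where A_i = (A - i v) ∩ K, K = span(w)
  fiberSize : ∀ {n d} → Subset n → V n → (Fin d → V n) → 𝔽 → ℕ
  fiberSize {n} A v w i =
    length (filter (λ x → inSpan w x ∧ A (x +V (i ·V v)) Data.Bool.≟ true) (allVecs n))
    where import Data.Bool

  omega : ∀ {n d} → Subset n → V n → (Fin d → V n) → ℕ
  omega A v w = length (filter (λ i → 0 Data.Nat.<? fiberSize A v w i) (allFin p))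
    where import Data.Nat

  -- membership of x ∈ F_p in C_{r+1} = {b_1,…,b_{r+1}} (0-indexed ordering b : Fin p → F_p)
  InC : (Fin p → 𝔽) → Fin p → 𝔽 → Set
  InC b r x = ∃ λ j → (toℕ j Data.Nat.≤ toℕ r) × (b j ≡ x)
    where import Data.Nat

{-# OPTIONS --safe #-}

-- Write K = span w ≅ 𝔽ₚⁿ⁻¹, so that the fibre A_t becomes {c | A (L c + t v)} for the injective
-- linear map L c = Σ cⱼ wⱼ. Given xᵢ ∈ C_{rᵢ} and yⱼ ∈ C_{sⱼ} with Σ xᵢ = Σ yⱼ, the iterated sumsets
-- Σ A_{xᵢ} and Σ A_{yⱼ} in K are disjoint, because A is (k,ℓ)-sum-free. In an abelian group of
-- exponent p and order p q a Kneser-type bound holds: for nonempty B, B′ either B + B′ is everything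
-- or |B| + |B′| ≤ |B + B′| + q. It is proved by induction on |B′| with Dyson's e-transform; when no
-- transform applies, B′ - b₀ consists of periods of B, and a set other than ∅ and the whole group
-- has at most q periods, since translating its set of periods by 0·g, …, (p-1)·g for a non-period g
-- gives p disjoint sets. Iterating the bound on both disjoint sumsets gives
-- Σ|A_{xᵢ}| + Σ|A_{yⱼ}| ≤ (p + k + ℓ - 2) pⁿ⁻², and |A_{b_{rᵢ}}| ≤ |A_{xᵢ}| since the fibres are
-- ordered by size. Condition (2) reduces to (1) by the same bound in 𝔽ₚ with q = 1
-- (Cauchy–Davenport), as |C_r| = r.

module Submission where

open import Defs
open import Data.Nat using (ℕ; zero; suc; _+_; _*_; _∸_; _^_; _%_; _≤_; _<_; _≥_; z≤n; s≤s; NonZero; >-nonZero; _<?_)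
open import Data.Nat.Properties hiding (_≟_)
open import Data.Nat.DivMod using (_mod_; %-distribˡ-+; %-distribˡ-*; m%n%n≡m%n; m%n<n; m<n⇒m%n≡m; n%n≡0; m*n%n≡0)
open import Data.Nat.GCD using (module Bézout)
open import Data.Nat.Coprimality using (coprime-Bézout; prime⇒coprime)
open import Data.Nat.Primality using (Prime; prime⇒nonZero)
open import Data.Nat.Solver using (module +-*-Solver)
open import Data.Bool using (Bool; true; false; _∧_; _∨_)
open import Data.Bool.Properties using (∧-conicalˡ; ∧-conicalʳ; ∧-zeroʳ; ¬-not) renaming (_≟_ to _≟ᵇ_)
open import Data.Bool.ListAction using (any)
open import Data.Fin using (Fin; toℕ) renaming (zero to fzero; suc to fsuc)
open import Data.Fin.Properties using (toℕ-injective; toℕ-fromℕ<; toℕ<n)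
  renaming (_≟_ to _≟F_; suc-injective to fsuc-injective)
open import Data.Vec using ([]; _∷_; lookup) renaming (map to mapᵥ)
open import Data.Vec.Properties
  using (≡-dec; lookup-zipWith; zipWith-assoc; zipWith-comm; zipWith-identityˡ; zipWith-inverseˡ)
open import Data.List using (List; []; _∷_; _++_; map; concatMap; tabulate; allFin; filter; length)
open import Data.List.Membership.Propositional using (_∈_; find; lose)
open import Data.List.Relation.Unary.Any using (here; there; any?)
open import Data.Product using (Σ; _×_; _,_; ∃; ∃₂; proj₁; proj₂)
open import Data.Sum using (_⊎_; inj₁; inj₂; fromInj₁)
import Data.Sum as Sum
open import Data.Empty using (⊥; ⊥-elim)
open import Function using (_∘_; id)
open import Function.Bundles using (_⇔_; mk⇔)
open import Function.Definitions using (Injective; Bijective)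
open import Level using (0ℓ)
open import Algebra.Core using (Op₁; Op₂)
open import Algebra.Bundles using (AbelianGroup)
open import Algebra.Structures using (IsAbelianGroup)
open import Algebra.Consequences.Propositional using (comm∧idˡ⇒id; comm∧invˡ⇒inv)
open import Algebra.Properties.CommutativeSemigroup +-commutativeSemigroup
  using () renaming (interchange to +-interchange)
open import Relation.Nullary using (¬_; Dec; yes; no; does; contradiction)
open import Relation.Nullary.Decidable using (map′; does-⇔; dec-true; dec-false; _×-dec_)
open import Relation.Unary using (Decidable)
open import Relation.Binary.Definitions using (DecidableEquality; tri<; tri≈; tri>)
open import Relation.Binary.PropositionalEquality
open import Relation.Binary.PropositionalEquality.Algebra using (isMagma)

𝟙 : Bool → ℕ
𝟙 true  = 1
𝟙 false = 0

𝟙-∧ : ∀ a b → 𝟙 (a ∧ b) ≡ 𝟙 a * 𝟙 b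
𝟙-∧ true  b = sym (+-identityʳ (𝟙 b))
𝟙-∧ false b = refl

𝟙[∨]+𝟙[∧]≡𝟙+𝟙 : ∀ a b → 𝟙 (a ∨ b) + 𝟙 (b ∧ a) ≡ 𝟙 a + 𝟙 b
𝟙[∨]+𝟙[∧]≡𝟙+𝟙 true  true  = refl
𝟙[∨]+𝟙[∧]≡𝟙+𝟙 true  false = refl
𝟙[∨]+𝟙[∧]≡𝟙+𝟙 false true  = refl
𝟙[∨]+𝟙[∧]≡𝟙+𝟙 false false = refl

𝟙-does-≟true : ∀ b → 𝟙 (does (b ≟ᵇ true)) ≡ 𝟙 b
𝟙-does-≟true true  = refl
𝟙-does-≟true false = refl

𝟙-does-mono : ∀ {P Q : Set} → (P → Q) → (P? : Dec P) (Q? : Dec Q) → 𝟙 (does P?) ≤ 𝟙 (does Q?)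
𝟙-does-mono P⇒Q (no _)  _       = z≤n
𝟙-does-mono P⇒Q (yes _) (yes _) = ≤-refl
𝟙-does-mono P⇒Q (yes p) (no ¬q) = contradiction (P⇒Q p) ¬q

≡true⇔≡true⇒≡ : ∀ {a b} → (a ≡ true → b ≡ true) → (b ≡ true → a ≡ true) → a ≡ b
≡true⇔≡true⇒≡ {true}          a⇒b b⇒a = sym (a⇒b refl)
≡true⇔≡true⇒≡ {false} {false} a⇒b b⇒a = refl
≡true⇔≡true⇒≡ {false} {true}  a⇒b b⇒a = b⇒a refl

does⇒ : ∀ {P : Set} (P? : Dec P) → does P? ≡ true → P
does⇒ (yes p) _ = p

∑ : {X : Set} → List X → (X → ℕ) → ℕ
∑ []       f = 0
∑ (x ∷ xs) f = f x + ∑ xs f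

module _ {X : Set} where

  ∑-cong : ∀ xs {f g : X → ℕ} → (∀ x → f x ≡ g x) → ∑ xs f ≡ ∑ xs g
  ∑-cong []       f≗g = refl
  ∑-cong (x ∷ xs) f≗g = cong₂ _+_ (f≗g x) (∑-cong xs f≗g)

  ∑-mono-≤ : ∀ xs {f g : X → ℕ} → (∀ x → f x ≤ g x) → ∑ xs f ≤ ∑ xs g
  ∑-mono-≤ []       f≤g = z≤n
  ∑-mono-≤ (x ∷ xs) f≤g = +-mono-≤ (f≤g x) (∑-mono-≤ xs f≤g)

  ∑-zero : ∀ xs → ∑ {X} xs (λ _ → 0) ≡ 0
  ∑-zero []       = refl
  ∑-zero (x ∷ xs) = ∑-zero xs

  ∑-distrib-+ : ∀ xs (f g : X → ℕ) → ∑ xs (λ x → f x + g x) ≡ ∑ xs f + ∑ xs g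
  ∑-distrib-+ []       f g = refl
  ∑-distrib-+ (x ∷ xs) f g =
    trans (cong (f x + g x +_) (∑-distrib-+ xs f g)) (+-interchange (f x) (g x) (∑ xs f) (∑ xs g))

  *-distribˡ-∑ : ∀ xs c (f : X → ℕ) → c * ∑ xs f ≡ ∑ xs (λ x → c * f x)
  *-distribˡ-∑ []       c f = *-zeroʳ c
  *-distribˡ-∑ (x ∷ xs) c f = trans (*-distribˡ-+ c (f x) (∑ xs f)) (cong (c * f x +_) (*-distribˡ-∑ xs c f))

  *-distribʳ-∑ : ∀ xs c (f : X → ℕ) → ∑ xs f * c ≡ ∑ xs (λ x → f x * c)
  *-distribʳ-∑ []       c f = refl
  *-distribʳ-∑ (x ∷ xs) c f = trans (*-distribʳ-+ c (f x) (∑ xs f)) (cong (f x * c +_) (*-distribʳ-∑ xs c f))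

  ∑-++ : ∀ xs ys (f : X → ℕ) → ∑ (xs ++ ys) f ≡ ∑ xs f + ∑ ys f
  ∑-++ []       ys f = refl
  ∑-++ (x ∷ xs) ys f = trans (cong (f x +_) (∑-++ xs ys f)) (sym (+-assoc (f x) _ _))

  ∑-≥1⇒∃ : ∀ xs (P : X → Bool) → 1 ≤ ∑ xs (𝟙 ∘ P) → ∃ λ x → P x ≡ true
  ∑-≥1⇒∃ (x ∷ xs) P 1≤∑ with P x in Px
  ... | true  = x , Px
  ... | false = ∑-≥1⇒∃ xs P 1≤∑

module _ {X Y : Set} where

  ∑-map : ∀ xs (g : X → Y) (f : Y → ℕ) → ∑ (map g xs) f ≡ ∑ xs (f ∘ g)
  ∑-map []       g f = refl
  ∑-map (x ∷ xs) g f = cong (f (g x) +_) (∑-map xs g f)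

  ∑-concatMap : ∀ xs (g : X → List Y) (f : Y → ℕ) → ∑ (concatMap g xs) f ≡ ∑ xs (λ x → ∑ (g x) f)
  ∑-concatMap []       g f = refl
  ∑-concatMap (x ∷ xs) g f = trans (∑-++ (g x) (concatMap g xs) f) (cong (∑ (g x) f +_) (∑-concatMap xs g f))

  ∑-comm : ∀ xs ys (f : X → Y → ℕ) → ∑ xs (λ x → ∑ ys (f x)) ≡ ∑ ys (λ y → ∑ xs (λ x → f x y))
  ∑-comm []       ys f = sym (∑-zero ys)
  ∑-comm (x ∷ xs) ys f =
    trans (cong (∑ ys (f x) +_) (∑-comm xs ys f)) (sym (∑-distrib-+ ys (f x) (λ y → ∑ xs (λ x → f x y))))

length-filter≡∑𝟙 : ∀ {X : Set} {P : X → Set} (P? : Decidable P) xs →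
                   length (filter P? xs) ≡ ∑ xs (𝟙 ∘ does ∘ P?)
length-filter≡∑𝟙 P? []       = refl
length-filter≡∑𝟙 P? (x ∷ xs) with does (P? x)
... | true  = cong suc (length-filter≡∑𝟙 P? xs)
... | false = length-filter≡∑𝟙 P? xs

sumℕ-cong : ∀ {m} {f g : Fin m → ℕ} → (∀ i → f i ≡ g i) → sumℕ f ≡ sumℕ g
sumℕ-cong {zero}  f≗g = refl
sumℕ-cong {suc m} f≗g = cong₂ _+_ (f≗g fzero) (sumℕ-cong (f≗g ∘ fsuc))

sumℕ-mono-≤ : ∀ {m} {f g : Fin m → ℕ} → (∀ i → f i ≤ g i) → sumℕ f ≤ sumℕ g
sumℕ-mono-≤ {zero}  f≤g = z≤n
sumℕ-mono-≤ {suc m} f≤g = +-mono-≤ (f≤g fzero) (sumℕ-mono-≤ (f≤g ∘ fsuc))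

sumℕ-const : ∀ m c → sumℕ {m} (λ _ → c) ≡ m * c
sumℕ-const zero    c = refl
sumℕ-const (suc m) c = cong (c +_) (sumℕ-const m c)

∑-tabulate : ∀ {X : Set} {m} (g : Fin m → X) (f : X → ℕ) → ∑ (tabulate g) f ≡ sumℕ (f ∘ g)
∑-tabulate {m = zero}  g f = refl
∑-tabulate {m = suc m} g f = cong (f (g fzero) +_) (∑-tabulate (g ∘ fsuc) f)

∑-allFin : ∀ m (f : Fin m → ℕ) → ∑ (allFin m) f ≡ sumℕ f
∑-allFin m f = ∑-tabulate {m = m} id f

sumℕ-𝟙-< : ∀ m R → R ≤ m → sumℕ {m} (λ j → 𝟙 (does (toℕ j <? R))) ≡ R
sumℕ-𝟙-< zero    zero    _         = refl
sumℕ-𝟙-< (suc m) zero    _         = sumℕ-𝟙-< m zero z≤n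
sumℕ-𝟙-< (suc m) (suc R) (s≤s R≤m) = cong suc (sumℕ-𝟙-< m R R≤m)

sumℕ-𝟙-≤1 : ∀ {m} (b : Fin m → Bool) → (∀ {i j} → b i ≡ true → b j ≡ true → i ≡ j) → sumℕ (𝟙 ∘ b) ≤ 1
sumℕ-𝟙-≤1 {zero}  b unique = z≤n
sumℕ-𝟙-≤1 {suc m} b unique with b fzero in b0
... | false = sumℕ-𝟙-≤1 (b ∘ fsuc) (λ bi bj → fsuc-injective (unique bi bj))
... | true  = ≤-reflexive (cong suc (trans (sumℕ-cong rest-false) (trans (sumℕ-const m 0) (*-zeroʳ m))))
  where
  rest-false : ∀ j → 𝟙 (b (fsuc j)) ≡ 0
  rest-false j with b (fsuc j) in bj
  ... | false = refl
  ... | true  = contradiction (unique b0 bj) λ ()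

record Enumeration (X : Set) : Set where
  field
    _≟_         : DecidableEquality X
    elements    : List X
    occurs-once : ∀ z → ∑ elements (λ x → 𝟙 (does (z ≟ x))) ≡ 1

module Counting {X : Set} (E : Enumeration X) where
  open Enumeration E public

  size : ℕ
  size = ∑ elements (λ _ → 1)

  card : (X → Bool) → ℕ
  card P = ∑ elements (𝟙 ∘ P)

  ∑-δ : ∀ z (f : X → ℕ) → ∑ elements (λ x → 𝟙 (does (z ≟ x)) * f x) ≡ f z
  ∑-δ z f = begin
    ∑ elements (λ x → 𝟙 (does (z ≟ x)) * f x)  ≡⟨ ∑-cong elements δ-at-z ⟩
    ∑ elements (λ x → 𝟙 (does (z ≟ x)) * f z)  ≡⟨ *-distribʳ-∑ elements (f z) _ ⟨
    ∑ elements (λ x → 𝟙 (does (z ≟ x))) * f z  ≡⟨ cong (_* f z) (occurs-once z) ⟩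
    1 * f z                                    ≡⟨ *-identityˡ (f z) ⟩
    f z                                        ∎
    where
    open ≡-Reasoning
    δ-at-z : ∀ x → 𝟙 (does (z ≟ x)) * f x ≡ 𝟙 (does (z ≟ x)) * f z
    δ-at-z x with z ≟ x
    ... | yes refl = refl
    ... | no  _    = refl

  ∑-reindex : (f g : X → X) → (∀ x → g (f x) ≡ x) → (∀ y → f (g y) ≡ y) →
              ∀ h → ∑ elements (h ∘ f) ≡ ∑ elements h
  ∑-reindex f g g∘f f∘g h = begin
    ∑ elements (h ∘ f)                                                ≡⟨ ∑-cong elements (λ x → ∑-δ (f x) h) ⟨
    ∑ elements (λ x → ∑ elements (λ y → 𝟙 (does (f x ≟ y)) * h y))  ≡⟨ ∑-comm elements elements _ ⟩
    ∑ elements (λ y → ∑ elements (λ x → 𝟙 (does (f x ≟ y)) * h y))  ≡⟨ ∑-cong elements (λ y → ∑-cong elements (swap y)) ⟩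
    ∑ elements (λ y → ∑ elements (λ x → 𝟙 (does (g y ≟ x)) * h y))  ≡⟨ ∑-cong elements (λ y → ∑-δ (g y) (λ _ → h y)) ⟩
    ∑ elements h                                                      ∎
    where
    open ≡-Reasoning
    swap : ∀ y x → 𝟙 (does (f x ≟ y)) * h y ≡ 𝟙 (does (g y ≟ x)) * h y
    swap y x = cong (λ b → 𝟙 b * h y) (does-⇔ (mk⇔ (λ fx≡y → trans (cong g (sym fx≡y)) (g∘f x))
                                                  (λ gy≡x → trans (cong f (sym gy≡x)) (f∘g y)))
                                             (f x ≟ y) (g y ≟ x))

  ∈-elements : ∀ z → z ∈ elements
  ∈-elements z = occurs⇒∈ elements (≤-reflexive (sym (occurs-once z)))
    where
    occurs⇒∈ : ∀ xs → 1 ≤ ∑ xs (λ x → 𝟙 (does (z ≟ x))) → z ∈ xs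
    occurs⇒∈ (x ∷ xs) occurs with z ≟ x
    ... | yes refl = here refl
    ... | no  _    = there (occurs⇒∈ xs occurs)

  ∃? : {P : X → Set} → Decidable P → Dec (∃ P)
  ∃? P? = map′ (λ some → let x , _ , Px = find some in x , Px)
               (λ (x , Px) → lose (∈-elements x) Px)
               (any? P? elements)

  card-mono-≤ : ∀ {P Q : X → Bool} → (∀ {x} → P x ≡ true → Q x ≡ true) → card P ≤ card Q
  card-mono-≤ {P} {Q} P⊆Q = ∑-mono-≤ elements 𝟙-mono
    where
    𝟙-mono : ∀ x → 𝟙 (P x) ≤ 𝟙 (Q x)
    𝟙-mono x with P x in Px
    ... | false = z≤n
    ... | true  rewrite P⊆Q Px = ≤-refl

  card≥1⇒∃ : ∀ {P : X → Bool} → 1 ≤ card P → ∃ λ x → P x ≡ true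
  card≥1⇒∃ {P} = ∑-≥1⇒∃ elements P

  ∃⇒card≥1 : ∀ {P : X → Bool} {z} → P z ≡ true → 1 ≤ card P
  ∃⇒card≥1 {P} {z} Pz = ≤-trans (≤-reflexive (sym (occurs-once z))) (∑-mono-≤ elements δ≤P)
    where
    δ≤P : ∀ x → 𝟙 (does (z ≟ x)) ≤ 𝟙 (P x)
    δ≤P x with z ≟ x
    ... | yes refl rewrite Pz = ≤-refl
    ... | no  _    = z≤n

  card-< : ∀ {P Q : X → Bool} {z} → (∀ {x} → P x ≡ true → Q x ≡ true) → Q z ≡ true → P z ≡ false →
           card P < card Q
  card-< {P} {Q} {z} P⊆Q Qz Pz = begin
    suc (card P)                                   ≡⟨ +-comm 1 (card P) ⟩
    card P + 1                                     ≡⟨ cong (card P +_) (occurs-once z) ⟨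
    card P + ∑ elements (λ x → 𝟙 (does (z ≟ x)))   ≡⟨ ∑-distrib-+ elements _ _ ⟨
    ∑ elements (λ x → 𝟙 (P x) + 𝟙 (does (z ≟ x)))  ≤⟨ ∑-mono-≤ elements P+δ≤Q ⟩
    card Q                                         ∎
    where
    open ≤-Reasoning
    P+δ≤Q : ∀ x → 𝟙 (P x) + 𝟙 (does (z ≟ x)) ≤ 𝟙 (Q x)
    P+δ≤Q x with z ≟ x
    ... | yes refl rewrite Pz | Qz = ≤-refl
    ... | no  _    with P x in Px
    ...   | false = z≤n
    ...   | true  rewrite P⊆Q Px = ≤-refl

  card-disjoint : ∀ {P Q : X → Bool} → (∀ {x} → P x ≡ true → Q x ≡ true → ⊥) → card P + card Q ≤ size
  card-disjoint {P} {Q} disjoint = begin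
    card P + card Q                       ≡⟨ ∑-distrib-+ elements _ _ ⟨
    ∑ elements (λ x → 𝟙 (P x) + 𝟙 (Q x))  ≤⟨ ∑-mono-≤ elements 𝟙+𝟙≤1 ⟩
    size                                  ∎
    where
    open ≤-Reasoning
    𝟙+𝟙≤1 : ∀ x → 𝟙 (P x) + 𝟙 (Q x) ≤ 1
    𝟙+𝟙≤1 x with P x in Px | Q x in Qx
    ... | true  | true  = ⊥-elim (disjoint Px Qx)
    ... | true  | false = ≤-refl
    ... | false | true  = ≤-refl
    ... | false | false = z≤n

  sumℕ-card-≤-size : ∀ {m} (P : Fin m → X → Bool) → (∀ {i j x} → P i x ≡ true → P j x ≡ true → i ≡ j) →
                     sumℕ (card ∘ P) ≤ size
  sumℕ-card-≤-size {m} P disjoint = begin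
    sumℕ (card ∘ P)                                    ≡⟨ ∑-allFin m (card ∘ P) ⟨
    ∑ (allFin m) (λ i → ∑ elements (𝟙 ∘ P i))          ≡⟨ ∑-comm (allFin m) elements _ ⟩
    ∑ elements (λ x → ∑ (allFin m) (λ i → 𝟙 (P i x)))  ≤⟨ ∑-mono-≤ elements at-most-one ⟩
    size                                               ∎
    where
    open ≤-Reasoning
    at-most-one : ∀ x → ∑ (allFin m) (λ i → 𝟙 (P i x)) ≤ 1
    at-most-one x = ≤-trans (≤-reflexive (∑-allFin m (λ i → 𝟙 (P i x)))) (sumℕ-𝟙-≤1 (λ i → P i x) disjoint)

does-any?≡any : ∀ {X : Set} {P : X → Set} (P? : Decidable P) xs → does (any? P? xs) ≡ any (does ∘ P?) xs
does-any?≡any P? []       = refl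
does-any?≡any P? (x ∷ xs) = cong (does (P? x) ∨_) (does-any?≡any P? xs)

module _ {X Y : Set} (EX : Enumeration X) (EY : Enumeration Y) where
  private
    module X = Counting EX
    module Y = Counting EY

  -- Phrased with any, so that Defs.inSpan w is definitionally inImage of c ↦ lincomb w (lookup c).
  inImage : (Y → X) → X → Bool
  inImage f x = any (λ y → does (f y X.≟ x)) Y.elements

  𝟙-inImage : ∀ {f} → Injective _≡_ _≡_ f → ∀ x → 𝟙 (inImage f x) ≡ ∑ Y.elements (λ y → 𝟙 (does (f y X.≟ x)))
  𝟙-inImage {f} f-injective x rewrite sym (does-any?≡any (λ y → f y X.≟ x) Y.elements)
    with any? (λ y → f y X.≟ x) Y.elements
  ... | yes has-preimage =
        let y₀ , _ , fy₀≡x = find has-preimage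
        in sym (trans (∑-cong Y.elements (λ y → cong 𝟙 (does-⇔ (preimage-unique fy₀≡x y) (f y X.≟ x) (y₀ Y.≟ y))))
                      (Y.occurs-once y₀))
    where
    preimage-unique : ∀ {y₀} → f y₀ ≡ x → ∀ y → (f y ≡ x) ⇔ (y₀ ≡ y)
    preimage-unique fy₀≡x y = mk⇔ (λ fy≡x → f-injective (trans fy₀≡x (sym fy≡x)))
                                  (λ y₀≡y → trans (cong f (sym y₀≡y)) fy₀≡x)
  ... | no no-preimage =
        sym (trans (∑-cong Y.elements (λ y → cong 𝟙 (dec-false (f y X.≟ x) (no-preimage ∘ lose (Y.∈-elements y)))))
                   (∑-zero Y.elements))

  card-inImage∧ : ∀ {f} → Injective _≡_ _≡_ f → ∀ P → X.card (λ x → inImage f x ∧ P x) ≡ Y.card (P ∘ f)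
  card-inImage∧ {f} f-injective P = begin
    ∑ X.elements (λ x → 𝟙 (inImage f x ∧ P x))
      ≡⟨ ∑-cong X.elements 𝟙-inImage∧ ⟩
    ∑ X.elements (λ x → ∑ Y.elements (λ y → 𝟙 (does (f y X.≟ x)) * 𝟙 (P x)))
      ≡⟨ ∑-comm X.elements Y.elements _ ⟩
    ∑ Y.elements (λ y → ∑ X.elements (λ x → 𝟙 (does (f y X.≟ x)) * 𝟙 (P x)))
      ≡⟨ ∑-cong Y.elements (λ y → X.∑-δ (f y) (𝟙 ∘ P)) ⟩
    ∑ Y.elements (λ y → 𝟙 (P (f y)))
      ∎
    where
    open ≡-Reasoning
    𝟙-inImage∧ : ∀ x → 𝟙 (inImage f x ∧ P x) ≡ ∑ Y.elements (λ y → 𝟙 (does (f y X.≟ x)) * 𝟙 (P x))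
    𝟙-inImage∧ x = begin
      𝟙 (inImage f x ∧ P x)                                ≡⟨ 𝟙-∧ (inImage f x) (P x) ⟩
      𝟙 (inImage f x) * 𝟙 (P x)                            ≡⟨ cong (_* 𝟙 (P x)) (𝟙-inImage f-injective x) ⟩
      ∑ Y.elements (λ y → 𝟙 (does (f y X.≟ x))) * 𝟙 (P x)  ≡⟨ *-distribʳ-∑ Y.elements (𝟙 (P x)) _ ⟩
      ∑ Y.elements (λ y → 𝟙 (does (f y X.≟ x)) * 𝟙 (P x))  ∎

-- Sumsets in finite abelian groups

record FiniteAbelianGroup : Set₁ where
  infixl 7 _∙_
  infix  8 _⁻¹
  field
    Carrier        : Set
    _∙_            : Carrier → Carrier → Carrier
    ε              : Carrier
    _⁻¹            : Carrier → Carrier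
    isAbelianGroup : IsAbelianGroup _≡_ _∙_ ε _⁻¹
    enumeration    : Enumeration Carrier

module FiniteAbelianGroupProperties (𝔾 : FiniteAbelianGroup) where

  open FiniteAbelianGroup 𝔾 public using (Carrier; _∙_; ε; _⁻¹)
  private
    G = Carrier
    abelianGroup : AbelianGroup 0ℓ 0ℓ
    abelianGroup = record { isAbelianGroup = FiniteAbelianGroup.isAbelianGroup 𝔾 }

  open AbelianGroup abelianGroup public
    using (_-_; assoc; comm; identityˡ; identityʳ; inverseʳ; rawMonoid; monoid; commutativeMonoid; commutativeSemigroup)
  open import Algebra.Properties.AbelianGroup abelianGroup public
    using (//-rightDividesˡ; //-rightDividesʳ; \\-leftDividesˡ; ⁻¹-involutive; inverseʳ-unique; ⁻¹-anti-homo‿-;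
           identityˡ-unique; x∙y⁻¹≈ε⇒x≈y)
  open import Algebra.Properties.CommutativeMonoid.Sum commutativeMonoid public
    using (sum-cong-≗) renaming (∑-distrib-+ to sum-distrib-∙)
  open import Algebra.Properties.CommutativeSemigroup commutativeSemigroup public using (interchange)
  open import Algebra.Definitions.RawMonoid rawMonoid public using (sum) renaming (_×_ to _·_)
  open import Algebra.Properties.Monoid.Mult monoid public using (×-homo-+; ×-assocˡ)
  open Counting (FiniteAbelianGroup.enumeration 𝔾) public

  x∙[y-x]≡y : ∀ x y → x ∙ (y - x) ≡ y
  x∙[y-x]≡y x y = trans (cong (x ∙_) (comm y (x ⁻¹))) (\\-leftDividesˡ x y)

  [x∙y]-x≡y : ∀ x y → (x ∙ y) - x ≡ y
  [x∙y]-x≡y x y = trans (cong (_- x) (comm x y)) (//-rightDividesʳ x y)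

  x∙[y-z]≡y∙[x-z] : ∀ x y z → x ∙ (y - z) ≡ y ∙ (x - z)
  x∙[y-z]≡y∙[x-z] x y z = begin
    x ∙ (y - z)  ≡⟨ assoc x y (z ⁻¹) ⟨
    x ∙ y - z    ≡⟨ cong (_- z) (comm x y) ⟩
    y ∙ x - z    ≡⟨ assoc y x (z ⁻¹) ⟩
    y ∙ (x - z)  ∎
    where open ≡-Reasoning

  [y∙e]∙[x-e]≡x∙y : ∀ x y e → (y ∙ e) ∙ (x - e) ≡ x ∙ y
  [y∙e]∙[x-e]≡x∙y x y e = begin
    (y ∙ e) ∙ (x ∙ e ⁻¹)  ≡⟨ interchange y e x (e ⁻¹) ⟩
    (y ∙ x) ∙ (e ∙ e ⁻¹)  ≡⟨ cong ((y ∙ x) ∙_) (inverseʳ e) ⟩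
    (y ∙ x) ∙ ε           ≡⟨ identityʳ (y ∙ x) ⟩
    y ∙ x                 ≡⟨ comm y x ⟩
    x ∙ y                 ∎
    where open ≡-Reasoning

  x∙[m+n]·g≡[x∙m·g]∙n·g : ∀ x m n g → x ∙ (m + n) · g ≡ (x ∙ m · g) ∙ n · g
  x∙[m+n]·g≡[x∙m·g]∙n·g x m n g = trans (cong (x ∙_) (×-homo-+ g m n)) (sym (assoc x (m · g) (n · g)))

  card-translate : ∀ (A : G → Bool) c → card (λ x → A (x ∙ c)) ≡ card A
  card-translate A c = ∑-reindex (_∙ c) (_- c) (//-rightDividesʳ c) (//-rightDividesˡ c) (𝟙 ∘ A)

  Nonempty : (G → Bool) → Set
  Nonempty A = ∃ λ a → A a ≡ true

  Full : (G → Bool) → Set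
  Full A = ∀ z → A z ≡ true

  infixl 6 _⊕_
  _⊕_ : (G → Bool) → (G → Bool) → G → Bool
  (A ⊕ B) z = does (∃? λ a → (A a ≟ᵇ true) ×-dec (B (z - a) ≟ᵇ true))

  ⊕-intro : ∀ {A B a b z} → A a ≡ true → B b ≡ true → a ∙ b ≡ z → (A ⊕ B) z ≡ true
  ⊕-intro {A} {B} {a} {b} Aa Bb refl =
    dec-true (∃? _) (a , Aa , subst (λ u → B u ≡ true) (sym ([x∙y]-x≡y a b)) Bb)

  ⊕-elim : ∀ {A B z} → (A ⊕ B) z ≡ true → ∃₂ λ a b → A a ≡ true × B b ≡ true × a ∙ b ≡ z
  ⊕-elim {A} {B} {z} z∈A⊕B with does⇒ (∃? _) z∈A⊕B
  ... | a , Aa , Bz-a = a , z - a , Aa , Bz-a , x∙[y-x]≡y a z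

  ⨁ : ∀ {k} → (Fin (suc k) → G → Bool) → G → Bool
  ⨁ {zero}  X = X fzero
  ⨁ {suc k} X = X fzero ⊕ ⨁ (X ∘ fsuc)

  ⨁-nonempty : ∀ {k} (X : Fin (suc k) → G → Bool) → (∀ i → Nonempty (X i)) → Nonempty (⨁ X)
  ⨁-nonempty {zero}  X nonempty = nonempty fzero
  ⨁-nonempty {suc k} X nonempty with nonempty fzero | ⨁-nonempty (X ∘ fsuc) (nonempty ∘ fsuc)
  ... | a , Xa | s , ⨁s = a ∙ s , ⊕-intro {X fzero} {⨁ (X ∘ fsuc)} Xa ⨁s refl

  ⨁-elim : ∀ {k} (X : Fin (suc k) → G → Bool) {z} → ⨁ X z ≡ true →
           ∃ λ (c : Fin (suc k) → G) → (∀ i → X i (c i) ≡ true) × sum c ≡ z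
  ⨁-elim {zero}  X {z} Xz = (λ _ → z) , (λ { fzero → Xz }) , identityʳ z
  ⨁-elim {suc k} X z∈⨁X with ⊕-elim {X fzero} z∈⨁X
  ... | a , s , Xa , ⨁s , a∙s≡z with ⨁-elim (X ∘ fsuc) ⨁s
  ...   | c , Xc , ∑c≡s = (λ { fzero → a ; (fsuc i) → c i }) , (λ { fzero → Xa ; (fsuc i) → Xc i }) ,
                          trans (cong (a ∙_) ∑c≡s) a∙s≡z

  IsPeriod : (G → Bool) → G → Set
  IsPeriod A t = ∀ x → A (x ∙ t) ≡ A x

  module _ {A : G → Bool} where

    period-ε : IsPeriod A ε
    period-ε x = cong A (identityʳ x)

    period-∙ : ∀ {s t} → IsPeriod A s → IsPeriod A t → IsPeriod A (s ∙ t)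
    period-∙ {s} {t} s-period t-period x =
      trans (cong A (sym (assoc x s t))) (trans (t-period (x ∙ s)) (s-period x))

    period-⁻¹ : ∀ {t} → IsPeriod A t → IsPeriod A (t ⁻¹)
    period-⁻¹ {t} t-period x = trans (sym (t-period (x - t))) (cong A (//-rightDividesˡ t x))

    period-· : ∀ m {t} → IsPeriod A t → IsPeriod A (m · t)
    period-· zero    t-period = period-ε
    period-· (suc m) t-period = period-∙ t-period (period-· m t-period)

    period-cancelˡ : ∀ {s t} → IsPeriod A s → IsPeriod A (s ∙ t) → IsPeriod A t
    period-cancelˡ {s} {t} s-period st-period =
      subst (IsPeriod A) ([x∙y]-x≡y s t) (period-∙ st-period (period-⁻¹ s-period))

    ∈-∉⇒¬period : ∀ {a c} → A a ≡ true → A c ≡ false → ¬ IsPeriod A (c - a)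
    ∈-∉⇒¬period {a} {c} Aa Ac c-a-period = contradiction (begin
      true             ≡⟨ Aa ⟨
      A a              ≡⟨ c-a-period a ⟨
      A (a ∙ (c - a))  ≡⟨ cong A (x∙[y-x]≡y a c) ⟩
      A c              ≡⟨ Ac ⟩
      false            ∎) λ ()
      where open ≡-Reasoning

  module DysonTransform (A B : G → Bool) (e : G) where

    A′ : G → Bool
    A′ x = A x ∨ B (x - e)

    B′ : G → Bool
    B′ y = B y ∧ A (y ∙ e)

    B′⊆B : ∀ {y} → B′ y ≡ true → B y ≡ true
    B′⊆B {y} = ∧-conicalˡ (B y) (A (y ∙ e))

    ⊕-shrinks : ∀ {z} → (A′ ⊕ B′) z ≡ true → (A ⊕ B) z ≡ true
    ⊕-shrinks z∈A′⊕B′ with ⊕-elim {A′} {B′} z∈A′⊕B′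
    ... | a , b , A′a , B′b , a∙b≡z with A a in Aa
    ...   | true  = ⊕-intro {A} {B} Aa (B′⊆B B′b) a∙b≡z
    ...   | false = ⊕-intro {A} {B} (∧-conicalʳ (B b) (A (b ∙ e)) B′b) A′a (trans ([y∙e]∙[x-e]≡x∙y a b e) a∙b≡z)

    card-A′+card-B′ : card A′ + card B′ ≡ card A + card B
    card-A′+card-B′ = begin
      card A′ + card B′                                  ≡⟨ cong (card A′ +_) card-B′ ⟩
      card A′ + card (λ x → B (x - e) ∧ A x)             ≡⟨ ∑-distrib-+ elements _ _ ⟨
      ∑ elements (λ x → 𝟙 (A′ x) + 𝟙 (B (x - e) ∧ A x))  ≡⟨ ∑-cong elements (λ x → 𝟙[∨]+𝟙[∧]≡𝟙+𝟙 (A x) (B (x - e))) ⟩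
      ∑ elements (λ x → 𝟙 (A x) + 𝟙 (B (x - e)))         ≡⟨ ∑-distrib-+ elements _ _ ⟩
      card A + card (λ x → B (x - e))                    ≡⟨ cong (card A +_) (card-translate B (e ⁻¹)) ⟩
      card A + card B                                    ∎
      where
      open ≡-Reasoning
      card-B′ : card B′ ≡ card (λ x → B (x - e) ∧ A x)
      card-B′ = trans (sym (card-translate B′ (e ⁻¹)))
                      (∑-cong elements (λ x → cong (λ y → 𝟙 (B (x - e) ∧ A y)) (//-rightDividesˡ e x)))

  -- A Kneser-type bound in groups of prime exponent

  module ElementaryAbelian (p q : ℕ) (p-prime : Prime p) (exponent : ∀ g → p · g ≡ ε) (size≡p*q : size ≡ p * q)
    where

    private instance
      p≢0 = prime⇒nonZero p-prime

    [m*p]·g≡ε : ∀ m g → (m * p) · g ≡ ε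
    [m*p]·g≡ε m g = begin
      (m * p) · g  ≡⟨ cong (_· g) (*-comm m p) ⟩
      (p * m) · g  ≡⟨ ×-assocˡ g p m ⟨
      p · (m · g)  ≡⟨ exponent (m · g) ⟩
      ε            ∎
      where open ≡-Reasoning

    period-of-multiple : ∀ {A d g} → 0 < d → d < p → IsPeriod A (d · g) → IsPeriod A g
    period-of-multiple {A} {d} {g} 0<d d<p dg-period
      with coprime-Bézout (prime⇒coprime p-prime {{>-nonZero 0<d}} d<p)
    ... | Bézout.-+ x y 1+xp≡yd = subst (IsPeriod A) y[dg]≡g (period-· y dg-period)
      where
      y[dg]≡g : y · (d · g) ≡ g
      y[dg]≡g = begin
        y · (d · g)      ≡⟨ ×-assocˡ g y d ⟩
        (y * d) · g      ≡⟨ cong (_· g) 1+xp≡yd ⟨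
        g ∙ (x * p) · g  ≡⟨ cong (g ∙_) ([m*p]·g≡ε x g) ⟩
        g ∙ ε            ≡⟨ identityʳ g ⟩
        g                ∎
        where open ≡-Reasoning
    ... | Bézout.+- x y 1+yd≡xp =
      subst (IsPeriod A) (⁻¹-involutive g) (period-⁻¹ (subst (IsPeriod A) y[dg]≡g⁻¹ (period-· y dg-period)))
      where
      y[dg]≡g⁻¹ : y · (d · g) ≡ g ⁻¹
      y[dg]≡g⁻¹ = inverseʳ-unique g _ (begin
        g ∙ y · (d · g)  ≡⟨ cong (g ∙_) (×-assocˡ g y d) ⟩
        g ∙ (y * d) · g  ≡⟨ cong (_· g) 1+yd≡xp ⟩
        (x * p) · g      ≡⟨ [m*p]·g≡ε x g ⟩
        ε                ∎)
        where open ≡-Reasoning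

    card-periods≤q : ∀ {A S : G → Bool} {a c} → A a ≡ true → A c ≡ false →
                     (∀ {t} → S t ≡ true → IsPeriod A t) → card S ≤ q
    card-periods≤q {A} {S} {a} {c} Aa Ac S⊆periods = *-cancelˡ-≤ p (begin
      p * card S                   ≡⟨ sumℕ-const p (card S) ⟨
      sumℕ {p} (λ _ → card S)      ≡⟨ sumℕ-cong {p} (λ i → card-translate S (toℕ i · g)) ⟨
      sumℕ {p} (card ∘ translate)  ≤⟨ sumℕ-card-≤-size translate translates-disjoint ⟩
      size                         ≡⟨ size≡p*q ⟩
      p * q                        ∎)
      where
      open ≤-Reasoning
      g : G
      g = c - a

      translate : Fin p → G → Bool
      translate i x = S (x ∙ toℕ i · g)

      no-two-translates : ∀ {i j x} → toℕ i < toℕ j → translate i x ≡ true → translate j x ≡ true → ⊥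
      no-two-translates {i} {j} {x} i<j Si Sj =
        ∈-∉⇒¬period Aa Ac (period-of-multiple (m<n⇒0<n∸m i<j) (≤-<-trans (m∸n≤m (toℕ j) (toℕ i)) (toℕ<n j))
          (period-cancelˡ (S⊆periods Si) (subst (IsPeriod A) split-j (S⊆periods Sj))))
        where
        split-j : x ∙ toℕ j · g ≡ (x ∙ toℕ i · g) ∙ (toℕ j ∸ toℕ i) · g
        split-j = trans (cong (λ m → x ∙ m · g) (sym (m+[n∸m]≡n (<⇒≤ i<j))))
                        (x∙[m+n]·g≡[x∙m·g]∙n·g x (toℕ i) (toℕ j ∸ toℕ i) g)

      translates-disjoint : ∀ {i j x} → translate i x ≡ true → translate j x ≡ true → i ≡ j
      translates-disjoint {i} {j} Si Sj with <-cmp (toℕ i) (toℕ j)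
      ... | tri< i<j _ _ = ⊥-elim (no-two-translates i<j Si Sj)
      ... | tri≈ _ i≡j _ = toℕ-injective i≡j
      ... | tri> _ _ j<i = ⊥-elim (no-two-translates j<i Sj Si)

    closed-sumset-bound : ∀ {A B a₀ b₀} → A a₀ ≡ true → B b₀ ≡ true →
      (∀ {a b b′} → A a ≡ true → B b ≡ true → B b′ ≡ true → A (a ∙ (b - b′)) ≡ true) →
      Full (A ⊕ B) ⊎ card A + card B ≤ card (A ⊕ B) + q
    closed-sumset-bound {A} {B} {a₀} {b₀} Aa₀ Bb₀ closed with ∃? (λ c → A c ≟ᵇ false)
    ... | no  A-full =
          inj₁ (λ z → ⊕-intro {A} {B} (¬-not (λ Az-b₀ → A-full (z - b₀ , Az-b₀))) Bb₀ (//-rightDividesˡ b₀ z))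
    ... | yes (c , Ac) = inj₂ (+-mono-≤ card-A≤card-A⊕B card-B≤q)
      where
      open ≤-Reasoning
      card-A≤card-A⊕B : card A ≤ card (A ⊕ B)
      card-A≤card-A⊕B = begin
        card A                   ≡⟨ card-translate A (b₀ ⁻¹) ⟨
        card (λ z → A (z - b₀))  ≤⟨ card-mono-≤ (λ {z} Az-b₀ → ⊕-intro {A} {B} Az-b₀ Bb₀ (//-rightDividesˡ b₀ z)) ⟩
        card (A ⊕ B)             ∎

      difference-period : ∀ {b} → B b ≡ true → IsPeriod A (b - b₀)
      difference-period {b} Bb x =
        sym (≡true⇔≡true⇒≡ (λ Ax → closed Ax Bb Bb₀) (λ Ax∙t → subst (λ y → A y ≡ true) back (closed Ax∙t Bb₀ Bb)))
        where
        back : (x ∙ (b - b₀)) ∙ (b₀ - b) ≡ x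
        back = trans (cong ((x ∙ (b - b₀)) ∙_) (sym (⁻¹-anti-homo‿- b b₀))) (//-rightDividesʳ (b - b₀) x)

      card-B≤q : card B ≤ q
      card-B≤q = begin
        card B                   ≡⟨ card-translate B b₀ ⟨
        card (λ t → B (t ∙ b₀))  ≤⟨ card-periods≤q Aa₀ Ac (λ {t} B[t∙b₀] →
                                      subst (IsPeriod A) (//-rightDividesʳ b₀ t) (difference-period B[t∙b₀])) ⟩
        q                        ∎

    private
      sumset-bound-below : ∀ n {A B} → card B ≤ n → Nonempty A → Nonempty B →
                           Full (A ⊕ B) ⊎ card A + card B ≤ card (A ⊕ B) + q
      sumset-bound-below zero {B = B} card-B≤0 _ (b , Bb) = ⊥-elim (1+n≰n (≤-trans (∃⇒card≥1 {B} Bb) card-B≤0))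
      sumset-bound-below (suc n) {A} {B} card-B≤1+n (a₀ , Aa₀) (b₀ , Bb₀)
        with ∃? (λ a → ∃? (λ b₁ → ∃? (λ b₂ →
               (A a ≟ᵇ true) ×-dec (B b₁ ≟ᵇ true) ×-dec (B b₂ ≟ᵇ true) ×-dec (A (a ∙ (b₁ - b₂)) ≟ᵇ false))))
      ... | no ¬escape =
            closed-sumset-bound Aa₀ Bb₀ (λ Aa Bb Bb′ → ¬-not (λ escape → ¬escape (_ , _ , _ , Aa , Bb , Bb′ , escape)))
      ... | yes (a , b₁ , b₂ , Aa , Bb₁ , Bb₂ , escape) =
            Sum.map (λ full z → ⊕-shrinks (full z)) transfer (sumset-bound-below n card-B′≤n (a , A′a) (b₂ , B′b₂))
        where
        open DysonTransform A B (a - b₂)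

        A′a : A′ a ≡ true
        A′a = cong (_∨ B (a - (a - b₂))) Aa

        B′b₂ : B′ b₂ ≡ true
        B′b₂ = trans (cong (λ y → B b₂ ∧ A y) (x∙[y-x]≡y b₂ a)) (cong₂ _∧_ Bb₂ Aa)

        B′b₁ : B′ b₁ ≡ false
        B′b₁ = trans (cong (λ y → B b₁ ∧ A y) (x∙[y-z]≡y∙[x-z] b₁ a b₂))
                     (trans (cong (B b₁ ∧_) escape) (∧-zeroʳ (B b₁)))

        card-B′≤n : card B′ ≤ n
        card-B′≤n = ≤-pred (≤-trans (card-< B′⊆B Bb₁ B′b₁) card-B≤1+n)

        transfer : card A′ + card B′ ≤ card (A′ ⊕ B′) + q → card A + card B ≤ card (A ⊕ B) + q
        transfer bound = ≤-trans (≤-reflexive (sym card-A′+card-B′)) (≤-trans bound (+-monoˡ-≤ q (card-mono-≤ ⊕-shrinks)))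

    sumset-bound : ∀ {A B} → Nonempty A → Nonempty B → Full (A ⊕ B) ⊎ card A + card B ≤ card (A ⊕ B) + q
    sumset-bound {B = B} = sumset-bound-below (card B) ≤-refl

    ⨁-bound : ∀ {k} (X : Fin (suc k) → G → Bool) → (∀ i → Nonempty (X i)) →
              Full (⨁ X) ⊎ sumℕ (card ∘ X) ≤ card (⨁ X) + k * q
    ⨁-bound {zero}  X nonempty = inj₂ ≤-refl
    ⨁-bound {suc k} X nonempty with nonempty fzero | ⨁-bound (X ∘ fsuc) (nonempty ∘ fsuc)
    ... | a , Xa | inj₁ full = inj₁ (λ z → ⊕-intro {X fzero} {⨁ (X ∘ fsuc)} Xa (full (z - a)) (x∙[y-x]≡y a z))
    ... | a , Xa | inj₂ bound
      with sumset-bound {X fzero} {⨁ (X ∘ fsuc)} (a , Xa) (⨁-nonempty (X ∘ fsuc) (nonempty ∘ fsuc))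
    ...   | inj₁ full   = inj₁ full
    ...   | inj₂ bound′ = inj₂ (begin
      c₀ + sumℕ (card ∘ X ∘ fsuc)  ≤⟨ +-monoʳ-≤ c₀ bound ⟩
      c₀ + (c⨁ + k * q)           ≡⟨ +-assoc c₀ c⨁ (k * q) ⟨
      c₀ + c⨁ + k * q             ≤⟨ +-monoˡ-≤ (k * q) bound′ ⟩
      card (⨁ X) + q + k * q      ≡⟨ +-assoc (card (⨁ X)) q (k * q) ⟩
      card (⨁ X) + suc k * q      ∎)
      where
      open ≤-Reasoning
      c₀ = card (X fzero)
      c⨁ = card (⨁ (X ∘ fsuc))

    disjoint-⨁-bound : ∀ {k l} (X : Fin (suc k) → G → Bool) (Y : Fin (suc l) → G → Bool) →
                       (∀ i → Nonempty (X i)) → (∀ j → Nonempty (Y j)) →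
                       (∀ {z} → ⨁ X z ≡ true → ⨁ Y z ≡ true → ⊥) →
                       sumℕ (card ∘ X) + sumℕ (card ∘ Y) ≤ (p + k + l) * q
    disjoint-⨁-bound {k} {l} X Y X-nonempty Y-nonempty disjoint
      with ⨁-nonempty X X-nonempty | ⨁-nonempty Y Y-nonempty | ⨁-bound X X-nonempty | ⨁-bound Y Y-nonempty
    ... | _       | y , ⨁Yy | inj₁ full    | _            = ⊥-elim (disjoint (full y) ⨁Yy)
    ... | x , ⨁Xx | _       | inj₂ _       | inj₁ full    = ⊥-elim (disjoint ⨁Xx (full x))
    ... | _       | _       | inj₂ X-bound | inj₂ Y-bound = begin
      sumℕ (card ∘ X) + sumℕ (card ∘ Y)            ≤⟨ +-mono-≤ X-bound Y-bound ⟩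
      (card (⨁ X) + k * q) + (card (⨁ Y) + l * q)  ≡⟨ +-interchange (card (⨁ X)) (k * q) (card (⨁ Y)) (l * q) ⟩
      (card (⨁ X) + card (⨁ Y)) + (k * q + l * q)  ≤⟨ +-monoˡ-≤ (k * q + l * q) (card-disjoint disjoint) ⟩
      size + (k * q + l * q)                       ≡⟨ cong (_+ (k * q + l * q)) size≡p*q ⟩
      p * q + (k * q + l * q)                      ≡⟨ solve 4 (λ p q k l → p :* q :+ (k :* q :+ l :* q)
                                                                         := (p :+ k :+ l) :* q) refl p q k l ⟩
      (p + k + l) * q                              ∎
      where
      open ≤-Reasoning
      open +-*-Solver

-- The groups 𝔽ₚ and 𝔽ₚⁿ

module _ {A : Set} where
  open import Algebra.Definitions (_≡_ {A = A}) using (Associative; Commutative; LeftIdentity; LeftInverse)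

  isAbelianGroup-≡ : {_∙_ : Op₂ A} {ε : A} {_⁻¹ : Op₁ A} →
                     Associative _∙_ → Commutative _∙_ → LeftIdentity ε _∙_ → LeftInverse ε _⁻¹ _∙_ →
                     IsAbelianGroup _≡_ _∙_ ε _⁻¹
  isAbelianGroup-≡ {_∙_} {_} {_⁻¹} assoc comm identityˡ inverseˡ = record
    { isGroup = record
      { isMonoid = record
        { isSemigroup = record { isMagma = isMagma _∙_ ; assoc = assoc }
        ; identity    = comm∧idˡ⇒id comm identityˡ
        }
      ; inverse = comm∧invˡ⇒inv comm inverseˡ
      ; ⁻¹-cong = cong _⁻¹
      }
    ; comm = comm
    }

Fin-enumeration : ∀ N → Enumeration (Fin N)
Fin-enumeration N = record { _≟_ = _≟F_ ; elements = allFin N ; occurs-once = λ z → trans (∑-allFin N _) (sumℕ-𝟙-≟ z) }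
  where
  sumℕ-𝟙-≟ : ∀ {N} (z : Fin N) → sumℕ (λ x → 𝟙 (does (z ≟F x))) ≡ 1
  sumℕ-𝟙-≟ {suc N} fzero    = cong suc (trans (sumℕ-const N 0) (*-zeroʳ N))
  sumℕ-𝟙-≟ {suc N} (fsuc z) = sumℕ-𝟙-≟ z

Fin-size : ∀ N → Counting.size (Fin-enumeration N) ≡ N
Fin-size N = trans (∑-allFin N (λ _ → 1)) (trans (sumℕ-const N 1) (*-identityʳ N))

module IntegersModulo (p : ℕ) {{_ : NonZero p}} where

  private
    toℕ-mod : ∀ m → toℕ (m mod p) ≡ m % p
    toℕ-mod m = toℕ-fromℕ< (m%n<n m p)

    mod-cong : ∀ {m n} → m % p ≡ n % p → m mod p ≡ n mod p
    mod-cong {m} {n} m%p≡n%p = toℕ-injective (trans (toℕ-mod m) (trans m%p≡n%p (sym (toℕ-mod n))))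

    0%p≡0 : 0 % p ≡ 0
    0%p≡0 = m*n%n≡0 0 p

    toℕ-0𝔽 : toℕ (0𝔽 p) ≡ 0
    toℕ-0𝔽 = trans (toℕ-mod 0) 0%p≡0

    toℕ-mod-id : ∀ (a : 𝔽 p) → toℕ a mod p ≡ a
    toℕ-mod-id a = toℕ-injective (trans (toℕ-mod (toℕ a)) (m<n⇒m%n≡m (toℕ<n a)))

    [m%p+n]%p≡[m+n]%p : ∀ m n → (m % p + n) % p ≡ (m + n) % p
    [m%p+n]%p≡[m+n]%p m n = begin
      (m % p + n) % p          ≡⟨ %-distribˡ-+ (m % p) n p ⟩
      (m % p % p + n % p) % p  ≡⟨ cong (λ k → (k + n % p) % p) (m%n%n≡m%n m p) ⟩
      (m % p + n % p) % p      ≡⟨ %-distribˡ-+ m n p ⟨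
      (m + n) % p              ∎
      where open ≡-Reasoning

    [m+n%p]%p≡[m+n]%p : ∀ m n → (m + n % p) % p ≡ (m + n) % p
    [m+n%p]%p≡[m+n]%p m n = begin
      (m + n % p) % p  ≡⟨ cong (_% p) (+-comm m (n % p)) ⟩
      (n % p + m) % p  ≡⟨ [m%p+n]%p≡[m+n]%p n m ⟩
      (n + m) % p      ≡⟨ cong (_% p) (+-comm n m) ⟩
      (m + n) % p      ∎
      where open ≡-Reasoning

    [m%p*n]%p≡[m*n]%p : ∀ m n → (m % p * n) % p ≡ (m * n) % p
    [m%p*n]%p≡[m*n]%p m n = begin
      (m % p * n) % p            ≡⟨ %-distribˡ-* (m % p) n p ⟩
      (m % p % p * (n % p)) % p  ≡⟨ cong (λ k → (k * (n % p)) % p) (m%n%n≡m%n m p) ⟩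
      (m % p * (n % p)) % p      ≡⟨ %-distribˡ-* m n p ⟨
      (m * n) % p                ∎
      where open ≡-Reasoning

  infixl 6 _+ₚ_
  infixl 7 _*ₚ_
  infix  8 -ₚ_

  _+ₚ_ : 𝔽 p → 𝔽 p → 𝔽 p
  _+ₚ_ = _+𝔽_ p

  _*ₚ_ : 𝔽 p → 𝔽 p → 𝔽 p
  _*ₚ_ = _*𝔽_ p

  -ₚ_ : 𝔽 p → 𝔽 p
  -ₚ a = (p ∸ toℕ a) mod p

  0ₚ : 𝔽 p
  0ₚ = 0𝔽 p

  +ₚ-assoc : ∀ a b c → (a +ₚ b) +ₚ c ≡ a +ₚ (b +ₚ c)
  +ₚ-assoc a b c = mod-cong (begin
    (toℕ (a +ₚ b) + toℕ c) % p         ≡⟨ cong (λ k → (k + toℕ c) % p) (toℕ-mod _) ⟩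
    ((toℕ a + toℕ b) % p + toℕ c) % p  ≡⟨ [m%p+n]%p≡[m+n]%p _ _ ⟩
    (toℕ a + toℕ b + toℕ c) % p        ≡⟨ cong (_% p) (+-assoc (toℕ a) _ _) ⟩
    (toℕ a + (toℕ b + toℕ c)) % p      ≡⟨ [m+n%p]%p≡[m+n]%p _ _ ⟨
    (toℕ a + (toℕ b + toℕ c) % p) % p  ≡⟨ cong (λ k → (toℕ a + k) % p) (toℕ-mod _) ⟨
    (toℕ a + toℕ (b +ₚ c)) % p         ∎)
    where open ≡-Reasoning

  +ₚ-comm : ∀ a b → a +ₚ b ≡ b +ₚ a
  +ₚ-comm a b = cong (_mod p) (+-comm (toℕ a) (toℕ b))

  +ₚ-identityˡ : ∀ a → 0ₚ +ₚ a ≡ a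
  +ₚ-identityˡ a = trans (cong (λ k → (k + toℕ a) mod p) toℕ-0𝔽) (toℕ-mod-id a)

  +ₚ-inverseˡ : ∀ a → -ₚ a +ₚ a ≡ 0ₚ
  +ₚ-inverseˡ a = mod-cong (begin
    (toℕ (-ₚ a) + toℕ a) % p       ≡⟨ cong (λ k → (k + toℕ a) % p) (toℕ-mod _) ⟩
    ((p ∸ toℕ a) % p + toℕ a) % p  ≡⟨ [m%p+n]%p≡[m+n]%p _ _ ⟩
    (p ∸ toℕ a + toℕ a) % p        ≡⟨ cong (_% p) (m∸n+n≡m (<⇒≤ (toℕ<n a))) ⟩
    p % p                          ≡⟨ n%n≡0 p ⟩
    0                              ≡⟨ 0%p≡0 ⟨
    0 % p                          ∎)
    where open ≡-Reasoning

  *ₚ-distribʳ-+ₚ : ∀ a b c → (a +ₚ b) *ₚ c ≡ a *ₚ c +ₚ b *ₚ c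
  *ₚ-distribʳ-+ₚ a b c = mod-cong (begin
    (toℕ (a +ₚ b) * toℕ c) % p                       ≡⟨ cong (λ k → (k * toℕ c) % p) (toℕ-mod _) ⟩
    ((toℕ a + toℕ b) % p * toℕ c) % p                ≡⟨ [m%p*n]%p≡[m*n]%p _ _ ⟩
    ((toℕ a + toℕ b) * toℕ c) % p                    ≡⟨ cong (_% p) (*-distribʳ-+ (toℕ c) (toℕ a) _) ⟩
    (toℕ a * toℕ c + toℕ b * toℕ c) % p              ≡⟨ [m%p+n]%p≡[m+n]%p _ _ ⟨
    ((toℕ a * toℕ c) % p + toℕ b * toℕ c) % p        ≡⟨ [m+n%p]%p≡[m+n]%p _ _ ⟨
    ((toℕ a * toℕ c) % p + (toℕ b * toℕ c) % p) % p  ≡⟨ cong₂ (λ k l → (k + l) % p) (toℕ-mod _) (toℕ-mod _) ⟨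
    (toℕ (a *ₚ c) + toℕ (b *ₚ c)) % p                ∎)
    where open ≡-Reasoning

  *ₚ-zeroˡ : ∀ c → 0ₚ *ₚ c ≡ 0ₚ
  *ₚ-zeroˡ c = cong (λ k → (k * toℕ c) mod p) toℕ-0𝔽

  𝔽-group : FiniteAbelianGroup
  𝔽-group = record
    { Carrier        = 𝔽 p
    ; _∙_            = _+ₚ_
    ; ε              = 0ₚ
    ; _⁻¹            = -ₚ_
    ; isAbelianGroup = isAbelianGroup-≡ +ₚ-assoc +ₚ-comm +ₚ-identityˡ +ₚ-inverseˡ
    ; enumeration    = Fin-enumeration p
    }

  module 𝔽ᴳ = FiniteAbelianGroupProperties 𝔽-group

  ·≡mod : ∀ m a → m 𝔽ᴳ.· a ≡ (m * toℕ a) mod p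
  ·≡mod zero    a = refl
  ·≡mod (suc m) a = begin
    a +ₚ m 𝔽ᴳ.· a                            ≡⟨ cong (a +ₚ_) (·≡mod m a) ⟩
    (toℕ a + toℕ ((m * toℕ a) mod p)) mod p  ≡⟨ mod-cong (trans (cong (λ k → (toℕ a + k) % p) (toℕ-mod _))
                                                                ([m+n%p]%p≡[m+n]%p _ _)) ⟩
    (suc m * toℕ a) mod p                    ∎
    where open ≡-Reasoning

  𝔽-exponent : ∀ a → p 𝔽ᴳ.· a ≡ 0ₚ
  𝔽-exponent a =
    trans (·≡mod p a) (mod-cong (trans (cong (_% p) (*-comm p (toℕ a))) (trans (m*n%n≡0 (toℕ a) p) (sym 0%p≡0))))

  infixl 6 _+ᵥ_
  infixr 7 _·ᵥ_

  _+ᵥ_ : ∀ {n} → V p n → V p n → V p n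
  _+ᵥ_ = _+V_ p

  _·ᵥ_ : ∀ {n} → 𝔽 p → V p n → V p n
  _·ᵥ_ = _·V_ p

  0ᵥ : ∀ {n} → V p n
  0ᵥ = 0V p

  -ᵥ_ : ∀ {n} → V p n → V p n
  -ᵥ_ = mapᵥ -ₚ_

  V-enumeration : ∀ n → Enumeration (V p n)
  V-enumeration n = record { _≟_ = ≡-dec _≟F_ ; elements = allVecs p n ; occurs-once = occurs-once n }
    where
    open Counting (Fin-enumeration p) using (∑-δ)
    occurs-once : ∀ n (z : V p n) → ∑ (allVecs p n) (λ x → 𝟙 (does (≡-dec _≟F_ z x))) ≡ 1
    occurs-once zero    []      = refl
    occurs-once (suc n) (b ∷ z) = begin
      ∑ (allVecs p (suc n)) (λ x → 𝟙 (does (≡-dec _≟F_ (b ∷ z) x)))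
        ≡⟨ ∑-concatMap (allFin p) _ _ ⟩
      ∑ (allFin p) (λ a → ∑ (map (a ∷_) (allVecs p n)) (λ x → 𝟙 (does (≡-dec _≟F_ (b ∷ z) x))))
        ≡⟨ ∑-cong (allFin p) (λ a → ∑-map (allVecs p n) (a ∷_) _) ⟩
      ∑ (allFin p) (λ a → ∑ (allVecs p n) (λ x → 𝟙 (does (b ≟F a) ∧ does (≡-dec _≟F_ z x))))
        ≡⟨ ∑-cong (allFin p) (λ a → ∑-cong (allVecs p n) (λ x → 𝟙-∧ (does (b ≟F a)) _)) ⟩
      ∑ (allFin p) (λ a → ∑ (allVecs p n) (λ x → 𝟙 (does (b ≟F a)) * 𝟙 (does (≡-dec _≟F_ z x))))
        ≡⟨ ∑-cong (allFin p) (λ a → *-distribˡ-∑ (allVecs p n) (𝟙 (does (b ≟F a))) _) ⟨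
      ∑ (allFin p) (λ a → 𝟙 (does (b ≟F a)) * ∑ (allVecs p n) (λ x → 𝟙 (does (≡-dec _≟F_ z x))))
        ≡⟨ ∑-cong (allFin p) (λ a → cong (𝟙 (does (b ≟F a)) *_) (occurs-once n z)) ⟩
      ∑ (allFin p) (λ a → 𝟙 (does (b ≟F a)) * 1)
        ≡⟨ ∑-δ b (λ _ → 1) ⟩
      1 ∎
      where open ≡-Reasoning

  V-size : ∀ n → Counting.size (V-enumeration n) ≡ p ^ n
  V-size zero    = refl
  V-size (suc n) = begin
    ∑ (allVecs p (suc n)) (λ _ → 1)                               ≡⟨ ∑-concatMap (allFin p) _ _ ⟩
    ∑ (allFin p) (λ a → ∑ (map (a ∷_) (allVecs p n)) (λ _ → 1))  ≡⟨ ∑-cong (allFin p) (λ a →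
                                                                       trans (∑-map (allVecs p n) (a ∷_) _) (V-size n)) ⟩
    ∑ (allFin p) (λ _ → p ^ n)                                    ≡⟨ ∑-allFin p _ ⟩
    sumℕ {p} (λ _ → p ^ n)                                        ≡⟨ sumℕ-const p (p ^ n) ⟩
    p * p ^ n                                                     ∎
    where open ≡-Reasoning

  V-group : ℕ → FiniteAbelianGroup
  V-group n = record
    { Carrier        = V p n
    ; _∙_            = _+ᵥ_
    ; ε              = 0ᵥ
    ; _⁻¹            = -ᵥ_
    ; isAbelianGroup = isAbelianGroup-≡ (zipWith-assoc +ₚ-assoc) (zipWith-comm +ₚ-comm)
                                        (zipWith-identityˡ +ₚ-identityˡ) (zipWith-inverseˡ +ₚ-inverseˡ)
    ; enumeration    = V-enumeration n
    }

  module Vᴳ {n} = FiniteAbelianGroupProperties (V-group n)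

  ·-∷ : ∀ {n} m a (x : V p n) → m Vᴳ.· (a ∷ x) ≡ m 𝔽ᴳ.· a ∷ m Vᴳ.· x
  ·-∷ zero    a x = refl
  ·-∷ (suc m) a x = cong ((a ∷ x) +ᵥ_) (·-∷ m a x)

  V-exponent : ∀ {n} (x : V p n) → p Vᴳ.· x ≡ 0ᵥ
  V-exponent []      with p Vᴳ.· []
  ... | [] = refl
  V-exponent (a ∷ x) = trans (·-∷ p a x) (cong₂ _∷_ (𝔽-exponent a) (V-exponent x))

  ·ᵥ-distribʳ : ∀ {n} a b (x : V p n) → (a +ₚ b) ·ᵥ x ≡ a ·ᵥ x +ᵥ b ·ᵥ x
  ·ᵥ-distribʳ a b []      = refl
  ·ᵥ-distribʳ a b (c ∷ x) = cong₂ _∷_ (*ₚ-distribʳ-+ₚ a b c) (·ᵥ-distribʳ a b x)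

  ·ᵥ-zeroˡ : ∀ {n} (x : V p n) → 0ₚ ·ᵥ x ≡ 0ᵥ
  ·ᵥ-zeroˡ []      = refl
  ·ᵥ-zeroˡ (c ∷ x) = cong₂ _∷_ (*ₚ-zeroˡ c) (·ᵥ-zeroˡ x)

  sum𝔽≡sum : ∀ {k} (x : Fin k → 𝔽 p) → sum𝔽 p x ≡ 𝔽ᴳ.sum x
  sum𝔽≡sum {zero}  x = refl
  sum𝔽≡sum {suc k} x = cong (x fzero +ₚ_) (sum𝔽≡sum (x ∘ fsuc))

  sumV≡sum : ∀ {n k} (f : Fin k → V p n) → sumV p f ≡ Vᴳ.sum f
  sumV≡sum {k = zero}  f = refl
  sumV≡sum {k = suc k} f = cong (f fzero +ᵥ_) (sumV≡sum (f ∘ fsuc))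

  sum-·ᵥ : ∀ {n k} (x : Fin k → 𝔽 p) (v : V p n) → Vᴳ.sum (λ i → x i ·ᵥ v) ≡ 𝔽ᴳ.sum x ·ᵥ v
  sum-·ᵥ {k = zero}  x v = sym (·ᵥ-zeroˡ v)
  sum-·ᵥ {k = suc k} x v = trans (cong (x fzero ·ᵥ v +ᵥ_) (sum-·ᵥ (x ∘ fsuc) v)) (sym (·ᵥ-distribʳ (x fzero) _ v))

  lookup≡0ₚ⇒≡0ᵥ : ∀ {n} (x : V p n) → (∀ j → lookup x j ≡ 0ₚ) → x ≡ 0ᵥ
  lookup≡0ₚ⇒≡0ᵥ []      x≡0 = refl
  lookup≡0ₚ⇒≡0ᵥ (a ∷ x) x≡0 = cong₂ _∷_ (x≡0 fzero) (lookup≡0ₚ⇒≡0ᵥ x (x≡0 ∘ fsuc))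

-- Fibres of A over the decomposition (v, K)

module _ (p : ℕ) {{_ : NonZero p}} where

  open IntegersModulo p

  module LinearCombination {n d} (w : Fin d → V p n) where

    L : V p d → V p n
    L c = lincomb p w (lookup c)

    L≡sum : ∀ c → L c ≡ Vᴳ.sum (λ j → lookup c j ·ᵥ w j)
    L≡sum c = sumV≡sum (λ j → lookup c j ·ᵥ w j)

    L-∙ : ∀ c c′ → L (c +ᵥ c′) ≡ L c +ᵥ L c′
    L-∙ c c′ = begin
      L (c +ᵥ c′)
        ≡⟨ L≡sum (c +ᵥ c′) ⟩
      Vᴳ.sum (λ j → lookup (c +ᵥ c′) j ·ᵥ w j)
        ≡⟨ Vᴳ.sum-cong-≗ lookup-+ᵥ ⟩
      Vᴳ.sum (λ j → lookup c j ·ᵥ w j +ᵥ lookup c′ j ·ᵥ w j)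
        ≡⟨ Vᴳ.sum-distrib-∙ (λ j → lookup c j ·ᵥ w j) _ ⟩
      Vᴳ.sum (λ j → lookup c j ·ᵥ w j) +ᵥ Vᴳ.sum (λ j → lookup c′ j ·ᵥ w j)
        ≡⟨ cong₂ _+ᵥ_ (L≡sum c) (L≡sum c′) ⟨
      L c +ᵥ L c′
        ∎
      where
      open ≡-Reasoning
      lookup-+ᵥ : ∀ j → lookup (c +ᵥ c′) j ·ᵥ w j ≡ lookup c j ·ᵥ w j +ᵥ lookup c′ j ·ᵥ w j
      lookup-+ᵥ j = trans (cong (_·ᵥ w j) (lookup-zipWith _+ₚ_ j c c′)) (·ᵥ-distribʳ (lookup c j) (lookup c′ j) (w j))

    L-ε : L 0ᵥ ≡ 0ᵥ
    L-ε = Vᴳ.identityˡ-unique (L 0ᵥ) (L 0ᵥ) (trans (sym (L-∙ 0ᵥ 0ᵥ)) (cong L (Vᴳ.identityˡ 0ᵥ)))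

    L-sum : ∀ {k} (c : Fin k → V p d) → L (Vᴳ.sum c) ≡ Vᴳ.sum (L ∘ c)
    L-sum {zero}  c = L-ε
    L-sum {suc k} c = trans (L-∙ (c fzero) _) (cong (L (c fzero) +ᵥ_) (L-sum (c ∘ fsuc)))

    L-injective : LinIndep p w → Injective _≡_ _≡_ L
    L-injective independent {c} {c′} Lc≡Lc′ =
      Vᴳ.x∙y⁻¹≈ε⇒x≈y c c′ (lookup≡0ₚ⇒≡0ᵥ (c Vᴳ.- c′) (independent (lookup (c Vᴳ.- c′)) L[c-c′]≡0ᵥ))
      where
      L[c-c′]≡0ᵥ : L (c Vᴳ.- c′) ≡ 0ᵥ
      L[c-c′]≡0ᵥ = Vᴳ.identityˡ-unique (L (c Vᴳ.- c′)) (L c′)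
                     (trans (sym (L-∙ (c Vᴳ.- c′) c′)) (trans (cong L (Vᴳ.//-rightDividesˡ c′ c)) Lc≡Lc′))

    sumV-affine : ∀ {k} (c : Fin k → V p d) (x : Fin k → 𝔽 p) (v : V p n) →
                  sumV p (λ i → L (c i) +ᵥ x i ·ᵥ v) ≡ L (Vᴳ.sum c) +ᵥ sum𝔽 p x ·ᵥ v
    sumV-affine c x v = begin
      sumV p (λ i → L (c i) +ᵥ x i ·ᵥ v)         ≡⟨ sumV≡sum (λ i → L (c i) +ᵥ x i ·ᵥ v) ⟩
      Vᴳ.sum (λ i → L (c i) +ᵥ x i ·ᵥ v)         ≡⟨ Vᴳ.sum-distrib-∙ (L ∘ c) (λ i → x i ·ᵥ v) ⟩
      Vᴳ.sum (L ∘ c) +ᵥ Vᴳ.sum (λ i → x i ·ᵥ v)  ≡⟨ cong₂ _+ᵥ_ (L-sum c)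
                                                          (trans (cong (_·ᵥ v) (sum𝔽≡sum x)) (sym (sum-·ᵥ x v))) ⟨
      L (Vᴳ.sum c) +ᵥ sum𝔽 p x ·ᵥ v              ∎
      where open ≡-Reasoning

    fiberSize≡card : LinIndep p w → ∀ A v t → fiberSize p A v w t ≡ Vᴳ.card (λ c → A (L c +ᵥ t ·ᵥ v))
    fiberSize≡card independent A v t = begin
      fiberSize p A v w t
        ≡⟨ length-filter≡∑𝟙 (λ x → inSpan p w x ∧ A (x +ᵥ t ·ᵥ v) ≟ᵇ true) (allVecs p n) ⟩
      ∑ (allVecs p n) (λ x → 𝟙 (does (inSpan p w x ∧ A (x +ᵥ t ·ᵥ v) ≟ᵇ true)))
        ≡⟨ ∑-cong (allVecs p n) (λ x → 𝟙-does-≟true _) ⟩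
      ∑ (allVecs p n) (λ x → 𝟙 (inSpan p w x ∧ A (x +ᵥ t ·ᵥ v)))
        ≡⟨ card-inImage∧ (V-enumeration n) (V-enumeration d) (L-injective independent) (λ x → A (x +ᵥ t ·ᵥ v)) ⟩
      Vᴳ.card (λ c → A (L c +ᵥ t ·ᵥ v))
        ∎
      where open ≡-Reasoning

  SumsetsMeet : ∀ {k l} → (Fin p → 𝔽 p) → (Fin k → Fin p) → (Fin l → Fin p) → Set
  SumsetsMeet {k} {l} b r s = Σ (Fin k → 𝔽 p) λ x → Σ (Fin l → 𝔽 p) λ y →
    (∀ i → InC p b (r i) (x i)) × (∀ j → InC p b (s j) (y j)) × (sum𝔽 p x ≡ sum𝔽 p y)

  module Ordering (b : Fin p → 𝔽 p) (b-bijective : Bijective _≡_ _≡_ b) where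

    b⁻¹ : 𝔽 p → Fin p
    b⁻¹ y = proj₁ (proj₂ b-bijective y)

    b∘b⁻¹ : ∀ y → b (b⁻¹ y) ≡ y
    b∘b⁻¹ y = proj₂ (proj₂ b-bijective y) refl

    b⁻¹∘b : ∀ j → b⁻¹ (b j) ≡ j
    b⁻¹∘b j = proj₁ b-bijective (b∘b⁻¹ (b j))

    C : Fin p → 𝔽 p → Bool
    C r x = does (toℕ (b⁻¹ x) <? suc (toℕ r))

    C⇒InC : ∀ {r x} → C r x ≡ true → InC p b r x
    C⇒InC {r} {x} Crx = b⁻¹ x , ≤-pred (does⇒ (toℕ (b⁻¹ x) <? suc (toℕ r)) Crx) , b∘b⁻¹ x

    C-nonempty : ∀ r → 𝔽ᴳ.Nonempty (C r)
    C-nonempty r =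
      b r , subst (λ j → does (toℕ j <? suc (toℕ r)) ≡ true) (sym (b⁻¹∘b r)) (dec-true (toℕ r <? suc (toℕ r)) ≤-refl)

    card-C : ∀ r → 𝔽ᴳ.card (C r) ≡ suc (toℕ r)
    card-C r = begin
      ∑ (allFin p) (𝟙 ∘ C r)                                ≡⟨ 𝔽ᴳ.∑-reindex b b⁻¹ b⁻¹∘b b∘b⁻¹ (𝟙 ∘ C r) ⟨
      ∑ (allFin p) (𝟙 ∘ C r ∘ b)                            ≡⟨ ∑-cong (allFin p) (λ j →
                                                                 cong (λ i → 𝟙 (does (toℕ i <? suc (toℕ r)))) (b⁻¹∘b j)) ⟩
      ∑ (allFin p) (λ j → 𝟙 (does (toℕ j <? suc (toℕ r))))  ≡⟨ ∑-allFin p _ ⟩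
      sumℕ {p} (λ j → 𝟙 (does (toℕ j <? suc (toℕ r))))      ≡⟨ sumℕ-𝟙-< p (suc (toℕ r)) (toℕ<n r) ⟩
      suc (toℕ r)                                           ∎
      where open ≡-Reasoning

    module _ (f : 𝔽 p → ℕ) (decreasing : ∀ i j → toℕ i ≤ toℕ j → f (b j) ≤ f (b i)) where

      InC⇒≤ : ∀ {r x} → InC p b r x → f (b r) ≤ f x
      InC⇒≤ {r} (j , j≤r , refl) = decreasing j r j≤r

      support≤ : ∀ r → f (b r) ≡ 0 → length (filter (λ t → 0 <? f t) (allFin p)) ≤ toℕ r
      support≤ r fbr≡0 = begin
        length (filter (λ t → 0 <? f t) (allFin p))     ≡⟨ length-filter≡∑𝟙 (λ t → 0 <? f t) (allFin p) ⟩
        ∑ (allFin p) (λ t → 𝟙 (does (0 <? f t)))        ≡⟨ 𝔽ᴳ.∑-reindex b b⁻¹ b⁻¹∘b b∘b⁻¹ _ ⟨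
        ∑ (allFin p) (λ j → 𝟙 (does (0 <? f (b j))))    ≤⟨ ∑-mono-≤ (allFin p) (λ j →
                                                             𝟙-does-mono (before j) (0 <? f (b j)) (toℕ j <? toℕ r)) ⟩
        ∑ (allFin p) (λ j → 𝟙 (does (toℕ j <? toℕ r)))  ≡⟨ ∑-allFin p _ ⟩
        sumℕ {p} (λ j → 𝟙 (does (toℕ j <? toℕ r)))      ≡⟨ sumℕ-𝟙-< p (toℕ r) (<⇒≤ (toℕ<n r)) ⟩
        toℕ r                                           ∎
        where
        open ≤-Reasoning
        before : ∀ j → 0 < f (b j) → toℕ j < toℕ r
        before j 0<fbj = ≰⇒> (λ r≤j → <⇒≱ 0<fbj (≤-trans (decreasing r j r≤j) (≤-reflexive fbr≡0)))

      positive-below-ω : ∀ r → toℕ r < length (filter (λ t → 0 <? f t) (allFin p)) → 0 < f (b r)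
      positive-below-ω r r<ω with f (b r) in fbr
      ... | suc _ = s≤s z≤n
      ... | zero  = ⊥-elim (<⇒≱ r<ω (support≤ r fbr))

  module _ (p-prime : Prime p) where

    sumsets-meet : ∀ {k l} (b : Fin p → 𝔽 p) → Bijective _≡_ _≡_ b →
                   (r : Fin (suc k) → Fin p) (s : Fin (suc l) → Fin p) →
                   suc (p + k + l) ≤ sumℕ (λ i → suc (toℕ (r i))) + sumℕ (λ j → suc (toℕ (s j))) →
                   SumsetsMeet b r s
    sumsets-meet {k} {l} b b-bijective r s large =
      decide (𝔽ᴳ.∃? (λ z → (𝔽ᴳ.⨁ X z ≟ᵇ true) ×-dec (𝔽ᴳ.⨁ Y z ≟ᵇ true)))
      where
      open Ordering b b-bijective
      open 𝔽ᴳ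
      open ElementaryAbelian p 1 p-prime 𝔽-exponent (trans (Fin-size p) (sym (*-identityʳ p)))

      X : Fin (suc k) → 𝔽 p → Bool
      X = C ∘ r

      Y : Fin (suc l) → 𝔽 p → Bool
      Y = C ∘ s

      decide : Dec (∃ λ z → ⨁ X z ≡ true × ⨁ Y z ≡ true) → SumsetsMeet b r s
      decide (yes (z , ⨁Xz , ⨁Yz)) with ⨁-elim X ⨁Xz | ⨁-elim Y ⨁Yz
      ... | x , Xx , ∑x≡z | y , Yy , ∑y≡z =
            x , y , C⇒InC ∘ Xx , C⇒InC ∘ Yy , trans (sum𝔽≡sum x) (trans ∑x≡z (sym (trans (sum𝔽≡sum y) ∑y≡z)))
      decide (no disjoint) = ⊥-elim (<⇒≱ large (begin
        sumℕ (λ i → suc (toℕ (r i))) + sumℕ (λ j → suc (toℕ (s j)))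
          ≡⟨ cong₂ _+_ (sumℕ-cong (card-C ∘ r)) (sumℕ-cong (card-C ∘ s)) ⟨
        sumℕ (card ∘ X) + sumℕ (card ∘ Y)
          ≤⟨ disjoint-⨁-bound X Y (C-nonempty ∘ r) (C-nonempty ∘ s) (λ ⨁Xz ⨁Yz → disjoint (_ , ⨁Xz , ⨁Yz)) ⟩
        (p + k + l) * 1
          ≡⟨ *-identityʳ (p + k + l) ⟩
        p + k + l
          ∎))
        where open ≤-Reasoning

    fiber-bound : ∀ {k l n} (A : Subset p (suc (suc n))) → SumFree p (suc k) (suc l) A →
      (v : V p (suc (suc n))) (w : Fin (suc n) → V p (suc (suc n))) → LinIndep p w →
      (b : Fin p → 𝔽 p) → Bijective _≡_ _≡_ b →
      (∀ i j → toℕ i ≤ toℕ j → fiberSize p A v w (b j) ≤ fiberSize p A v w (b i)) →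
      (r : Fin (suc k) → Fin p) (s : Fin (suc l) → Fin p) →
      (∀ i → toℕ (r i) < omega p A v w) → (∀ j → toℕ (s j) < omega p A v w) →
      SumsetsMeet b r s →
      sumℕ (λ i → fiberSize p A v w (b (r i))) + sumℕ (λ j → fiberSize p A v w (b (s j))) ≤ (p + k + l) * p ^ n
    fiber-bound {k} {l} {n} A (_ , sum-free) v w independent b b-bijective decreasing r s r<ω s<ω
                (x , y , x∈C , y∈C , ∑x≡∑y) = begin
      sumℕ (fiber ∘ b ∘ r) + sumℕ (fiber ∘ b ∘ s)
        ≤⟨ +-mono-≤ (sumℕ-mono-≤ (InC⇒≤ fiber decreasing ∘ x∈C)) (sumℕ-mono-≤ (InC⇒≤ fiber decreasing ∘ y∈C)) ⟩
      sumℕ (fiber ∘ x) + sumℕ (fiber ∘ y)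
        ≡⟨ cong₂ _+_ (sumℕ-cong (fiber≡card ∘ x)) (sumℕ-cong (fiber≡card ∘ y)) ⟩
      sumℕ (card ∘ X) + sumℕ (card ∘ Y)
        ≤⟨ disjoint-⨁-bound X Y (fiber-nonempty r<ω x∈C) (fiber-nonempty s<ω y∈C) disjoint ⟩
      (p + k + l) * p ^ n
        ∎
      where
      open ≤-Reasoning
      open Ordering b b-bijective
      open LinearCombination w
      open Vᴳ {suc n}
      open ElementaryAbelian p (p ^ n) p-prime V-exponent (V-size (suc n))

      fiber : 𝔽 p → ℕ
      fiber = fiberSize p A v w

      F : 𝔽 p → V p (suc n) → Bool
      F t c = A (L c +ᵥ t ·ᵥ v)

      fiber≡card : ∀ t → fiber t ≡ card (F t)
      fiber≡card = fiberSize≡card independent A v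

      X : Fin (suc k) → V p (suc n) → Bool
      X = F ∘ x

      Y : Fin (suc l) → V p (suc n) → Bool
      Y = F ∘ y

      fiber-nonempty : ∀ {m} {r : Fin m → Fin p} {x : Fin m → 𝔽 p} → (∀ i → toℕ (r i) < omega p A v w) →
                       (∀ i → InC p b (r i) (x i)) → ∀ i → Nonempty (F (x i))
      fiber-nonempty {x = x} r<ω x∈C i = card≥1⇒∃ (begin
        1               ≤⟨ positive-below-ω fiber decreasing _ (r<ω i) ⟩
        fiber (b _)     ≤⟨ InC⇒≤ fiber decreasing (x∈C i) ⟩
        fiber (x i)     ≡⟨ fiber≡card (x i) ⟩
        card (F (x i))  ∎)

      disjoint : ∀ {z} → ⨁ X z ≡ true → ⨁ Y z ≡ true → ⊥
      disjoint ⨁Xz ⨁Yz with ⨁-elim X ⨁Xz | ⨁-elim Y ⨁Yz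
      ... | c , Xc , ∑c≡z | d , Yd , ∑d≡z =
            sum-free ((λ i → L (c i) +ᵥ x i ·ᵥ v) , (λ j → L (d j) +ᵥ y j ·ᵥ v) , Xc , Yd ,
                      trans (sumV-affine c x v)
                            (trans (cong₂ (λ u t → L u +ᵥ t ·ᵥ v) (trans ∑c≡z (sym ∑d≡z)) ∑x≡∑y)
                                   (sym (sumV-affine d y v))))

p+[1+k]+[1+l]≡2+[p+k+l] : ∀ p k l → p + suc k + suc l ≡ suc (suc (p + k + l))
p+[1+k]+[1+l]≡2+[p+k+l] p k l = trans (+-suc (p + suc k) l) (cong (λ m → suc (m + l)) (+-suc p k))

lemma3p6 : (k l p n : ℕ) → l < k → 1 ≤ l → {{_ : NonZero p}} → Prime p → 2 ≤ n →
    (A : Subset p n) → SumFree p k l A →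
    (v : V p n) (w : Fin (n ∸ 1) → V p n) → LinIndep p w →
    ¬ (∃ λ c → lincomb p w c ≡ v) →
    (b : Fin p → 𝔽 p) → Bijective _≡_ _≡_ b →
    (∀ i j → toℕ i ≤ toℕ j → fiberSize p A v w (b j) ≤ fiberSize p A v w (b i)) →
    (r : Fin k → Fin p) (s : Fin l → Fin p) →
    (∀ i → toℕ (r i) < omega p A v w) → (∀ j → toℕ (s j) < omega p A v w) →
    ((Σ (Fin k → 𝔽 p) λ x → Σ (Fin l → 𝔽 p) λ y →
        (∀ i → InC p b (r i) (x i)) × (∀ j → InC p b (s j) (y j)) ×
        (sum𝔽 p x ≡ sum𝔽 p y))
     ⊎ (sumℕ (λ i → suc (toℕ (r i))) + sumℕ (λ j → suc (toℕ (s j))) ≥ p + k + l ∸ 1)) →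
    sumℕ (λ i → fiberSize p A v w (b (r i))) + sumℕ (λ j → fiberSize p A v w (b (s j)))
      ≤ (p + k + l ∸ 2) * p ^ (n ∸ 2)
lemma3p6 zero    l       p n             ()
lemma3p6 (suc k) zero    p n             _ ()
lemma3p6 (suc k) (suc l) p zero          _ _ _ ()
lemma3p6 (suc k) (suc l) p (suc zero)    _ _ _ (s≤s ())
lemma3p6 (suc k) (suc l) p (suc (suc n)) _ _ p-prime _ A sum-free v w independent _ b b-bijective decreasing r s r<ω s<ω
         meet-or-large rewrite p+[1+k]+[1+l]≡2+[p+k+l] p k l =
  fiber-bound p p-prime A sum-free v w independent b b-bijective decreasing r s r<ω s<ω
    (fromInj₁ (sumsets-meet p p-prime b b-bijective r s) meet-or-large)
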